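{- For integers $n\ge 2$ and $0<d<n$, we have $M^{[n-d]}(d,n)=\binom{n}{d}-1$.
   Context: Group testing setting: a population of $n$ items contains exactly $d$ defective items, where $d$ is known in advance. A test is applied to a subset of the population and its outcome is positive if the subset contains at least one defective item and negative otherwise. Tests are performed sequentially (adaptively): the result of each test is known before the next test is chosen. An algorithm solves the $(d,n)$-problem if it always identifies the set of defective items. $M^{[k]}(d,n)$ denotes the minimum, over all such sequential algorithms in which every tested subset has size exactly $k$, of the worst-case number of tests used; if no such algorithm exists, $M^{[k]}(d,n)=\infty$. -}

module Defs where

open import Data.Nat using (ℕ; zero; suc; _≤_; _+_)
open import Data.Bool using (Bool; true; false; _∧_; _∨_)
open import Data.Vec using (Vec; []; _∷_)
open import Data.Fin.Subset using (Subset; ∣_∣)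
open import Data.Product using (Σ; _×_)
open import Relation.Binary.PropositionalEquality using (_≡_)

-- Outcome of a test on subset S when the defective set is D:
-- true (positive) iff S ∩ D is nonempty.
intersects : ∀ {n} → Subset n → Subset n → Bool
intersects []       []       = false
intersects (s ∷ S) (x ∷ D) = (s ∧ x) ∨ intersects S D

-- Sequential (adaptive) algorithms on a population Fin n in which every
-- tested subset has size exactly k: binary decision trees.
data Alg (n k : ℕ) : Set where
  leaf : Subset n → Alg n k
  test : (S : Subset n) → ∣ S ∣ ≡ k → (pos neg : Alg n k) → Alg n k

run : ∀ {n k} → Alg n k → Subset n → Subset n
run (leaf out)         D = out
run (test S _ pos neg) D with intersects S D
... | true  = run pos D
... | false = run neg D

numTests : ∀ {n k} → Alg n k → Subset n → ℕ
numTests (leaf _)           D = zero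
numTests (test S _ pos neg) D with intersects S D
... | true  = suc (numTests pos D)
... | false = suc (numTests neg D)

Solves : ∀ {n k} → ℕ → Alg n k → Set
Solves {n} d A = (D : Subset n) → ∣ D ∣ ≡ d → run A D ≡ D

WorstCaseAtMost : ∀ {n k} → ℕ → Alg n k → ℕ → Set
WorstCaseAtMost {n} d A m = (D : Subset n) → ∣ D ∣ ≡ d → numTests A D ≤ m

M[_]_,_≡_ : ℕ → ℕ → ℕ → ℕ → Set
M[ k ] d , n ≡ m =
  Σ (Alg n k) (λ A → Solves d A × WorstCaseAtMost d A m)
  × ((A : Alg n k) (m' : ℕ) → Solves d A → WorstCaseAtMost d A m' → m ≤ m')

-- A test of size n − d is negative on a d-set D only when it is the
-- complement of D, so a negative answer always reveals D.  Testing the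
-- complements of the candidates one after another therefore finds D within
-- C(n,d) − 1 tests.  Conversely, the negative branches of a run are forced,
-- so an algorithm that stops within m tests has at most m + 1 possible
-- outputs, while a correct one must be able to output all C(n,d) candidates.
module Submission where

open import Defs
open import Data.Bool using (true; false)
open import Data.Bool.Properties using (not-involutive)
open import Data.Empty using (⊥-elim)
open import Data.Fin using (zero; suc)
open import Data.Fin.Properties using (injective⇒≤)
open import Data.Fin.Subset using (Subset; ∣_∣; ∁; ⊥; inside; outside)
open import Data.Fin.Subset.Properties using (∣∁p∣≡n∸∣p∣)
open import Data.List using (List; []; _∷_; _++_; map; length; lookup)
open import Data.List.Properties using (length-++; length-map)
open import Data.List.Membership.Propositional using (_∈_)
open import Data.List.Membership.Propositional.Properties
  using (∈-lookup; ∈-map⁺; ∈-map⁻; ∈-++⁺ˡ; ∈-++⁺ʳ)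
open import Data.List.Membership.Setoid.Properties using (index-injective)
open import Data.List.Relation.Binary.Subset.Propositional using (_⊆_)
open import Data.List.Relation.Unary.All as All using (All; []; _∷_)
import Data.List.Relation.Unary.All.Properties as All
open import Data.List.Relation.Unary.AllPairs using ([]; _∷_)
open import Data.List.Relation.Unary.Any using (here; there)
open import Data.List.Relation.Unary.Unique.Propositional using (Unique)
import Data.List.Relation.Unary.Unique.Propositional.Properties as Unique
open import Data.Nat using (ℕ; zero; suc; _+_; _∸_; _≤_; _<_; z≤n; s≤s)
open import Data.Nat.Combinatorics using (_C_; nCk+nC[k+1]≡[n+1]C[k+1])
open import Data.Nat.Properties
open import Data.Product using (_×_; _,_)
open import Data.Vec using ([]; _∷_)
open import Data.Vec.Properties using (∷-injectiveʳ)
open import Function using (Injective)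
open import Relation.Nullary using (¬_; contradiction)
open import Relation.Binary.PropositionalEquality

lookup-injective : ∀ {a} {A : Set a} {xs : List A} →
                   Unique xs → Injective _≡_ _≡_ (lookup xs)
lookup-injective {xs = x ∷ xs} _          {zero}  {zero}  _  = refl
lookup-injective {xs = x ∷ xs} (x∉xs ∷ _) {zero}  {suc j} eq =
  ⊥-elim (All.lookup x∉xs (∈-lookup j) eq)
lookup-injective {xs = x ∷ xs} (x∉xs ∷ _) {suc i} {zero}  eq =
  ⊥-elim (All.lookup x∉xs (∈-lookup i) (sym eq))
lookup-injective {xs = x ∷ xs} (_    ∷ u) {suc i} {suc j} eq =
  cong suc (lookup-injective u eq)

unique-⊆⇒length≤ : ∀ {a} {A : Set a} {xs ys : List A} →
                   Unique xs → xs ⊆ ys → length xs ≤ length ys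
unique-⊆⇒length≤ {A = A} u xs⊆ys = injective⇒≤ λ {i} {j} eq →
  lookup-injective u
    (index-injective (setoid A) (xs⊆ys (∈-lookup i)) (xs⊆ys (∈-lookup j)) eq)

∁-involutive : ∀ {n} (p : Subset n) → ∁ (∁ p) ≡ p
∁-involutive []      = refl
∁-involutive (x ∷ p) = cong₂ _∷_ (not-involutive x) (∁-involutive p)

intersects-∁-self : ∀ {n} (p : Subset n) → intersects (∁ p) p ≡ false
intersects-∁-self []            = refl
intersects-∁-self (inside ∷ p)  = intersects-∁-self p
intersects-∁-self (outside ∷ p) = intersects-∁-self p

disjoint⇒∣p∣+∣q∣≤n : ∀ {n} (p q : Subset n) → intersects p q ≡ false →
                     ∣ p ∣ + ∣ q ∣ ≤ n
disjoint⇒∣p∣+∣q∣≤n []            []            _  = z≤n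
disjoint⇒∣p∣+∣q∣≤n (inside ∷ p)  (outside ∷ q) pq = s≤s (disjoint⇒∣p∣+∣q∣≤n p q pq)
disjoint⇒∣p∣+∣q∣≤n (outside ∷ p) (inside ∷ q)  pq =
  ≤-trans (≤-reflexive (+-suc ∣ p ∣ ∣ q ∣)) (s≤s (disjoint⇒∣p∣+∣q∣≤n p q pq))
disjoint⇒∣p∣+∣q∣≤n (outside ∷ p) (outside ∷ q) pq = m≤n⇒m≤1+n (disjoint⇒∣p∣+∣q∣≤n p q pq)

disjoint⇒≡∁ : ∀ {n} (p q : Subset n) → intersects p q ≡ false →
              n ≤ ∣ p ∣ + ∣ q ∣ → q ≡ ∁ p
disjoint⇒≡∁ []            []            _  _ = refl
disjoint⇒≡∁ (inside ∷ p)  (outside ∷ q) pq n≤ =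
  cong (outside ∷_) (disjoint⇒≡∁ p q pq (≤-pred n≤))
disjoint⇒≡∁ (outside ∷ p) (inside ∷ q)  pq n≤ =
  cong (inside ∷_) (disjoint⇒≡∁ p q pq (≤-pred (≤-trans n≤ (≤-reflexive (+-suc ∣ p ∣ ∣ q ∣)))))
disjoint⇒≡∁ (outside ∷ p) (outside ∷ q) pq n≤ =
  ⊥-elim (<⇒≱ n≤ (disjoint⇒∣p∣+∣q∣≤n p q pq))

subsetsOfSize : (n d : ℕ) → List (Subset n)
subsetsOfSize zero    zero    = [] ∷ []
subsetsOfSize zero    (suc d) = []
subsetsOfSize (suc n) zero    = map (outside ∷_) (subsetsOfSize n zero)
subsetsOfSize (suc n) (suc d) =
  map (inside ∷_) (subsetsOfSize n d) ++ map (outside ∷_) (subsetsOfSize n (suc d))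

∣∣-subsetsOfSize : ∀ n d → All (λ p → ∣ p ∣ ≡ d) (subsetsOfSize n d)
∣∣-subsetsOfSize zero    zero    = refl ∷ []
∣∣-subsetsOfSize zero    (suc d) = []
∣∣-subsetsOfSize (suc n) zero    = All.map⁺ (∣∣-subsetsOfSize n zero)
∣∣-subsetsOfSize (suc n) (suc d) = All.++⁺
  (All.map⁺ (All.map (cong suc) (∣∣-subsetsOfSize n d)))
  (All.map⁺ (∣∣-subsetsOfSize n (suc d)))

length-subsetsOfSize : ∀ n d → length (subsetsOfSize n d) ≡ n C d
length-subsetsOfSize zero    zero    = refl
length-subsetsOfSize zero    (suc d) = refl
length-subsetsOfSize (suc n) zero    =
  trans (length-map (outside ∷_) (subsetsOfSize n zero)) (length-subsetsOfSize n zero)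
length-subsetsOfSize (suc n) (suc d) = begin
  length (map (inside ∷_) (subsetsOfSize n d) ++ map (outside ∷_) (subsetsOfSize n (suc d)))
    ≡⟨ length-++ (map (inside ∷_) (subsetsOfSize n d)) ⟩
  length (map (inside ∷_) (subsetsOfSize n d)) + length (map (outside ∷_) (subsetsOfSize n (suc d)))
    ≡⟨ cong₂ _+_ (length-map (inside ∷_) (subsetsOfSize n d))
                 (length-map (outside ∷_) (subsetsOfSize n (suc d))) ⟩
  length (subsetsOfSize n d) + length (subsetsOfSize n (suc d))
    ≡⟨ cong₂ _+_ (length-subsetsOfSize n d) (length-subsetsOfSize n (suc d)) ⟩
  n C d + n C suc d
    ≡⟨ nCk+nC[k+1]≡[n+1]C[k+1] n d ⟩
  suc n C suc d ∎
  where open ≡-Reasoning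

∈-subsetsOfSize : ∀ {n} (p : Subset n) → p ∈ subsetsOfSize n ∣ p ∣
∈-subsetsOfSize []            = here refl
∈-subsetsOfSize (inside ∷ p)  = ∈-++⁺ˡ (∈-map⁺ (inside ∷_) (∈-subsetsOfSize p))
∈-subsetsOfSize {suc n} (outside ∷ p) with ∣ p ∣ | ∈-subsetsOfSize p
... | zero  | p∈ = ∈-map⁺ (outside ∷_) p∈
... | suc d | p∈ = ∈-++⁺ʳ (map (inside ∷_) (subsetsOfSize n d)) (∈-map⁺ (outside ∷_) p∈)

subsetsOfSize-unique : ∀ n d → Unique (subsetsOfSize n d)
subsetsOfSize-unique zero    zero    = [] ∷ []
subsetsOfSize-unique zero    (suc d) = []
subsetsOfSize-unique (suc n) zero    =
  Unique.map⁺ ∷-injectiveʳ (subsetsOfSize-unique n zero)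
subsetsOfSize-unique (suc n) (suc d) = Unique.++⁺
  (Unique.map⁺ ∷-injectiveʳ (subsetsOfSize-unique n d))
  (Unique.map⁺ ∷-injectiveʳ (subsetsOfSize-unique n (suc d)))
  headsDiffer
  where
  headsDiffer : ∀ {p} → ¬ (p ∈ map (inside ∷_) (subsetsOfSize n d)
                          × p ∈ map (outside ∷_) (subsetsOfSize n (suc d)))
  headsDiffer (p∈ins , p∈outs) with ∈-map⁻ (inside ∷_) p∈ins | ∈-map⁻ (outside ∷_) p∈outs
  ... | _ , _ , refl | _ , _ , ()

∣∁p∣≡n∸d : ∀ {n d} (p : Subset n) → ∣ p ∣ ≡ d → ∣ ∁ p ∣ ≡ n ∸ d
∣∁p∣≡n∸d {n} p ∣p∣≡d = trans (∣∁p∣≡n∸∣p∣ p) (cong (n ∸_) ∣p∣≡d)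

search : ∀ {n d} (ts : List (Subset n)) → All (λ t → ∣ t ∣ ≡ d) ts → Alg n (n ∸ d)
search []               []            = leaf ⊥
search (t ∷ [])         _             = leaf t
search (t ∷ ts@(_ ∷ _)) (∣t∣ ∷ ∣ts∣) = test (∁ t) (∣∁p∣≡n∸d t ∣t∣) (search ts ∣ts∣) (leaf t)

search-numTests : ∀ {n d} (ts : List (Subset n)) (∣ts∣ : All (λ t → ∣ t ∣ ≡ d) ts) D →
                  numTests (search ts ∣ts∣) D ≤ length ts ∸ 1
search-numTests []               []           D = z≤n
search-numTests (t ∷ [])         _            D = z≤n
search-numTests (t ∷ ts@(_ ∷ _)) (_ ∷ ∣ts∣) D with intersects (∁ t) D
... | true  = s≤s (search-numTests ts ∣ts∣ D)
... | false = s≤s z≤n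

search-solves : ∀ {n d} → d ≤ n →
                (ts : List (Subset n)) (∣ts∣ : All (λ t → ∣ t ∣ ≡ d) ts) →
                ∀ {D} → ∣ D ∣ ≡ d → D ∈ ts → run (search ts ∣ts∣) D ≡ D
search-solves _ (t ∷ []) _ _ (here refl) = refl
search-solves {n} d≤n (t ∷ ts@(_ ∷ _)) (∣t∣ ∷ ∣ts∣) {D} ∣D∣ D∈ with intersects (∁ t) D in eq | D∈
... | true  | here refl = contradiction (trans (sym eq) (intersects-∁-self t)) λ ()
... | true  | there D∈ts = search-solves d≤n ts ∣ts∣ ∣D∣ D∈ts
... | false | _ = sym (trans (disjoint⇒≡∁ (∁ t) D eq n≤∣∁t∣+∣D∣) (∁-involutive t))
  where
  n≤∣∁t∣+∣D∣ : n ≤ ∣ ∁ t ∣ + ∣ D ∣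
  n≤∣∁t∣+∣D∣ = ≤-reflexive (sym (trans (cong₂ _+_ (∣∁p∣≡n∸d t ∣t∣) ∣D∣) (m∸n+n≡m d≤n)))

-- Only positive answers branch: on a negative answer to S the instance is ∁ S.
outputsWithin : ∀ {n k} → Alg n k → ℕ → List (Subset n)
outputsWithin (leaf out)         _       = out ∷ []
outputsWithin (test _ _ _ _)     zero    = []
outputsWithin (test S _ pos neg) (suc m) = run neg (∁ S) ∷ outputsWithin pos m

length-outputsWithin : ∀ {n k} (A : Alg n k) m → length (outputsWithin A m) ≤ suc m
length-outputsWithin (leaf _)         _       = s≤s z≤n
length-outputsWithin (test _ _ _ _)   zero    = z≤n
length-outputsWithin (test _ _ pos _) (suc m) = s≤s (length-outputsWithin pos m)

run∈outputsWithin : ∀ {n k d} → k + d ≡ n → (A : Alg n k) {m : ℕ} {D : Subset n} →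
                    ∣ D ∣ ≡ d → numTests A D ≤ m → run A D ∈ outputsWithin A m
run∈outputsWithin _ (leaf _) _ _ = here refl
run∈outputsWithin k+d≡n (test S _ pos neg) {D = D} _ _ with intersects S D in eq
run∈outputsWithin k+d≡n (test S _ pos neg) {suc m} ∣D∣ (s≤s steps) | true =
  there (run∈outputsWithin k+d≡n pos ∣D∣ steps)
run∈outputsWithin k+d≡n (test S ∣S∣ pos neg) {suc m} {D} ∣D∣ _ | false =
  here (cong (run neg) (disjoint⇒≡∁ S D eq (≤-reflexive (sym (trans (cong₂ _+_ ∣S∣ ∣D∣) k+d≡n)))))

C≤1+worstCase : ∀ {n d} → d ≤ n → (A : Alg n (n ∸ d)) (m : ℕ) →
                Solves d A → WorstCaseAtMost d A m → n C d ≤ suc m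
C≤1+worstCase {n} {d} d≤n A m solves worstCase = begin
  n C d                          ≡⟨ length-subsetsOfSize n d ⟨
  length (subsetsOfSize n d)     ≤⟨ unique-⊆⇒length≤ (subsetsOfSize-unique n d) candidates⊆outputs ⟩
  length (outputsWithin A m)     ≤⟨ length-outputsWithin A m ⟩
  suc m                          ∎
  where
  open ≤-Reasoning
  candidates⊆outputs : subsetsOfSize n d ⊆ outputsWithin A m
  candidates⊆outputs {D} D∈ = subst (_∈ outputsWithin A m) (solves D ∣D∣)
    (run∈outputsWithin (m∸n+n≡m d≤n) A ∣D∣ (worstCase D ∣D∣))
    where
    ∣D∣ : ∣ D ∣ ≡ d
    ∣D∣ = All.lookup (∣∣-subsetsOfSize n d) D∈

M[n∸d]d,n≡nCd∸1 : ∀ n d → d ≤ n → M[ n ∸ d ] d , n ≡ (n C d ∸ 1)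
M[n∸d]d,n≡nCd∸1 n d d≤n =
  (search candidates sizes , solves , worstCase) ,
  λ A m solves′ worstCase′ → ∸-monoˡ-≤ 1 (C≤1+worstCase d≤n A m solves′ worstCase′)
  where
  candidates : List (Subset n)
  candidates = subsetsOfSize n d
  sizes : All (λ t → ∣ t ∣ ≡ d) candidates
  sizes = ∣∣-subsetsOfSize n d
  solves : Solves d (search candidates sizes)
  solves D ∣D∣ = search-solves d≤n candidates sizes ∣D∣
    (subst (λ j → D ∈ subsetsOfSize n j) ∣D∣ (∈-subsetsOfSize D))
  worstCase : WorstCaseAtMost d (search candidates sizes) (n C d ∸ 1)
  worstCase D _ = subst (λ c → numTests (search candidates sizes) D ≤ c ∸ 1)
    (length-subsetsOfSize n d) (search-numTests candidates sizes D)

proposition7 : (n d : ℕ) → 2 ≤ n → 0 < d → d < n →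
    M[ n ∸ d ] d , n ≡ ((n C d) ∸ 1)
proposition7 n d _ _ d<n = M[n∸d]d,n≡nCd∸1 n d (<⇒≤ d<n)
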